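{- Let $T=\{0,1,2\}$, let $A$ be a finite alphabet, and let $g\colon T^*\to A^*$ be a morphism. Let $\mathtt{vtm}$ be the fixed point $\tau^\omega(0)$ of the morphism $\tau$ on $T^*$ defined by $\tau(0)=012$, $\tau(1)=02$, $\tau(2)=1$. Suppose that: (1) $g(u)$ is squarefree for every factor $u$ of $\mathtt{vtm}$ of length $5$; (2) the only triple $(a,b,c)\in T^3$ for which there exist words $u,v,z,w\in A^*$ with $g(a)=uv$, $g(b)=zv$, $g(c)=zw$, $v\neq w$ and $u\neq z$, is $(a,b,c)=(0,1,0)$; (3) for each $a\in T$ one can write $g(a)=u_av_a$ with $u_a,v_a\in A^*$ such that whenever $y\in T^*$ and $x,z\in A^*$ satisfy $g(y)=xv_az$, then $z\in g(T^*)$. Then the infinite word $g(\mathtt{vtm})$ is squarefree.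
   Context: A (finite or infinite) word is squarefree if it has no factor of the form $yy$ with $y$ a nonempty word. The fixed point $\tau^\omega(0)=012021012102012\cdots$ is the limit of $\tau^n(0)$. For an infinite word $x=x_0x_1\cdots$, $g(x)=g(x_0)g(x_1)\cdots$. -}

module Defs where

open import Data.Nat using (ℕ; zero; suc; _+_)
open import Data.Fin using (Fin; zero; suc)
open import Data.List using (List; []; _∷_; _++_; concatMap; map; upTo)
open import Data.Product using (Σ; ∃; _×_; _,_)
open import Relation.Binary.PropositionalEquality using (_≡_; _≢_)
open import Relation.Nullary using (¬_)

T : Set
T = Fin 3

morph : {B C : Set} → (B → List C) → List B → List C
morph f = concatMap f

τ : T → List T
τ zero = zero ∷ suc zero ∷ suc (suc zero) ∷ []
τ (suc zero) = zero ∷ suc (suc zero) ∷ []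
τ (suc (suc zero)) = suc zero ∷ []

τpow : ℕ → List T
τpow zero = zero ∷ []
τpow (suc k) = morph τ (τpow k)

-- n-th letter of a list, with a default (never used below: |τ^(n+1)(0)| > n)
nth : {B : Set} → B → List B → ℕ → B
nth d [] _ = d
nth d (x ∷ xs) zero = x
nth d (x ∷ xs) (suc n) = nth d xs n

-- vtm = τ^ω(0) as an infinite word ℕ → T; its n-th letter is the n-th
-- letter of τ^(n+1)(0), which is a prefix of τ^ω(0) of length > n.
vtm : ℕ → T
vtm n = nth zero (τpow (suc n)) n

segment : {B : Set} → (ℕ → B) → ℕ → ℕ → List B
segment x i n = map (λ j → x (i + j)) (upTo n)

SquareFree : {B : Set} → List B → Set
SquareFree {B} w = ¬ (Σ (List B) λ x → Σ (List B) λ y → Σ (List B) λ z →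
                       (y ≢ []) × (w ≡ x ++ y ++ y ++ z))

-- the (finite or infinite) word g(x) = g(x_0)g(x_1)... is squarefree:
-- every finite factor of it, i.e. every g(x_0...x_{n-1}), is squarefree.
ImageSquareFree : {B C : Set} → (B → List C) → (ℕ → B) → Set
ImageSquareFree g x = ∀ n → SquareFree (morph g (segment x 0 n))

-- Conditions (1) and (2) make the letter images of g a bifix code: unless all of them are
-- empty they are nonempty, pairwise distinct, and none is a proper prefix or suffix of another.
-- Suppose the image of a prefix w of vtm contains a square YY, and let the two copies of Y begin
-- inside the images of the letters a₀ and b of w.  If a copy covers the image of a whole letter,
-- condition (3) makes everything after that letter an image again, and decoding from the right
-- shows that both copies begin at the same offset s; decoding from the left then shows that the
-- letters following a₀ and b agree up to the end of Y.  So either w contains a square, or a₀, b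
-- and the next letter form a triple as in (2), making 0Z1Z0 a factor of w.  Otherwise YY lies in
-- the image of a factor of w of length at most five, contrary to (1).
-- Prefixes of vtm are squarefree and avoid 0Z1Z0 because the same argument, applied to τ with
-- only 0 and 1 synchronizing, shows that τ preserves squarefree words avoiding 010 and 212.

module Submission where

open import Defs
open import Data.Nat using (ℕ; zero; suc; _+_; _≤_; _<_; z≤n; s≤s; _≤′_; ≤′-refl; ≤′-step)
open import Data.Nat.Properties using (≤-trans; ≤-reflexive; +-mono-≤; m<m+n; <-trans; n<1+n; <⇒≤; ≤⇒≤′)
open import Data.Fin using (Fin; zero; suc) renaming (_≟_ to _≟ᶠ_)
open import Data.List using (List; []; _∷_; _++_; length; reverse; _∷ʳ_; map; applyUpTo; initLast; _∷ʳ′_)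
open import Data.List.Properties
  using (++-assoc; ++-identityʳ; ++-identityˡ-unique; ++-identityʳ-unique; ++-cancelˡ; ++-conicalˡ; ++-conicalʳ;
         ∷-injective; concatMap-++; length-++; reverse-++; reverse-involutive; reverse-injective; unfold-reverse;
         map-applyUpTo; ++-monoid)
open import Data.Product using (Σ; _×_; _,_; proj₁; proj₂)
open import Data.Sum using (_⊎_; inj₁; inj₂)
open import Data.Empty using (⊥; ⊥-elim)
open import Function using (_∘_; case_of_)
open import Relation.Nullary using (¬_; Dec; yes; no)
open import Relation.Nullary.Decidable using (map′; ¬?; _×-dec_; _⊎-dec_; _→-dec_; toWitness)
open import Relation.Binary.Definitions using (DecidableEquality)
open import Data.List.Membership.Propositional using (_∈_)
open import Data.List.Membership.Propositional.Properties using (∈-map⁺; ∈-++⁺ˡ; ∈-++⁺ʳ)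
open import Data.List.Relation.Unary.All as All using (All; all?)
open import Data.List.Relation.Unary.Any using (here)
open import Data.Unit using (⊤; tt)
open import Relation.Binary.PropositionalEquality using (_≡_; _≢_; refl; sym; trans; cong; cong₂; subst; module ≡-Reasoning)
import Algebra.Solver.Monoid (++-monoid T) as Tˢ

module _ {A : Set} where

  Factor : List A → List A → Set
  Factor u w = Σ (List A) λ x → Σ (List A) λ z → w ≡ x ++ u ++ z

  prefix-factor : ∀ u v → Factor u (u ++ v)
  prefix-factor u v = [] , v , refl

  suffix-factor : ∀ u v → Factor v (u ++ v)
  suffix-factor u v = u , [] , cong (u ++_) (sym (++-identityʳ v))

  factor-trans : ∀ {u v w} → Factor u v → Factor v w → Factor u w
  factor-trans {u} (x , z , refl) (x′ , z′ , refl) = x′ ++ x , z ++ z′ , (begin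
    x′ ++ (x ++ u ++ z) ++ z′    ≡⟨ cong (x′ ++_) (++-assoc x (u ++ z) z′) ⟩
    x′ ++ x ++ (u ++ z) ++ z′    ≡⟨ cong (λ t → x′ ++ x ++ t) (++-assoc u z z′) ⟩
    x′ ++ x ++ u ++ z ++ z′      ≡⟨ ++-assoc x′ x _ ⟨
    (x′ ++ x) ++ u ++ z ++ z′    ∎)
    where open ≡-Reasoning

  square⇒¬squarefree : ∀ {w} y → y ≢ [] → Factor (y ++ y) w → ¬ SquareFree w
  square⇒¬squarefree y y≢[] (x , z , refl) sf = sf (x , y , z , y≢[] , cong (x ++_) (++-assoc y y z))

  squarefree-factor : ∀ {u w} → Factor u w → SquareFree w → SquareFree u
  squarefree-factor F sf (x , y , z , y≢[] , refl) =
    square⇒¬squarefree y y≢[] (factor-trans (x , z , cong (x ++_) (sym (++-assoc y y z))) F) sf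

  empty? : ∀ (y : List A) → Dec (y ≡ [])
  empty? []      = yes refl
  empty? (_ ∷ _) = no λ ()

  squarefree-[] : SquareFree {A} []
  squarefree-[] ([] , y , z , y≢[] , eq) = y≢[] (++-conicalˡ y _ (sym eq))

  ++-equidivisible : ∀ a b c d → a ++ b ≡ c ++ d →
    (Σ (List A) λ e → c ≡ a ++ e × b ≡ e ++ d) ⊎
    (Σ A λ x → Σ (List A) λ e → a ≡ c ++ x ∷ e × d ≡ x ∷ e ++ b)
  ++-equidivisible []      b c       d eq = inj₁ (c , refl , eq)
  ++-equidivisible (x ∷ a) b []      d eq = inj₂ (x , a , refl , sym eq)
  ++-equidivisible (x ∷ a) b (y ∷ c) d eq with ∷-injective eq
  ... | refl , eq′ with ++-equidivisible a b c d eq′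
  ...   | inj₁ (e , c≡ae , b≡ed)     = inj₁ (e , cong (x ∷_) c≡ae , b≡ed)
  ...   | inj₂ (z , e , a≡cze , d≡) = inj₂ (z , e , cong (x ∷_) a≡cze , d≡)

  length-++-≤ : ∀ (xs : List A) {ys m n} → length xs ≤ m → length ys ≤ n → length (xs ++ ys) ≤ m + n
  length-++-≤ xs l₁ l₂ = subst (_≤ _) (sym (length-++ xs)) (+-mono-≤ l₁ l₂)

  ++-extendʳ : ∀ {Y} (s m p t : List A) → Y ≡ s ++ m ++ p → Y ++ t ≡ s ++ m ++ p ++ t
  ++-extendʳ s m p t refl = trans (++-assoc s (m ++ p) t) (cong (s ++_) (++-assoc m p t))

-- Morphisms and codes

module Morphism {A : Set} (h : T → List A) where

  H : List T → List A
  H = morph h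

  H-++ : ∀ xs ys → H (xs ++ ys) ≡ H xs ++ H ys
  H-++ = concatMap-++ h

  H-erased : (∀ a → h a ≡ []) → ∀ w → H w ≡ []
  H-erased erased []      = refl
  H-erased erased (a ∷ w) = cong₂ _++_ (erased a) (H-erased erased w)

  H-nonempty : (∀ a → h a ≢ []) → ∀ {w} → w ≢ [] → H w ≢ []
  H-nonempty nonerasing {[]}    w≢[] _  = w≢[] refl
  H-nonempty nonerasing {a ∷ w} _    eq = nonerasing a (++-conicalˡ (h a) (H w) eq)

  data Cut (w : List T) (L R : List A) : Set where
    cut : ∀ w₁ a w₂ p s → w ≡ w₁ ++ a ∷ w₂ → h a ≡ p ++ s → s ≢ [] →
          L ≡ H w₁ ++ p → R ≡ s ++ H w₂ → Cut w L R

  cut-image : ∀ w {L R} → H w ≡ L ++ R → R ≢ [] → Cut w L R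
  cut-image []      {[]}    eq R≢[] = ⊥-elim (R≢[] (sym eq))
  cut-image (a ∷ w) {L} {R} eq R≢[] with ++-equidivisible (h a) (H w) L R eq
  ... | inj₁ (e , L≡hae , Hw≡eR) with cut-image w {e} Hw≡eR R≢[]
  ...   | cut w₁ b w₂ p s refl hb s≢[] refl R≡ =
          cut (a ∷ w₁) b w₂ p s refl hb s≢[] (trans L≡hae (sym (++-assoc (h a) (H w₁) p))) R≡
  cut-image (a ∷ w) {L} eq R≢[] | inj₂ (x , e , ha≡ , R≡) = cut [] a w L (x ∷ e) refl ha≡ (λ ()) refl R≡

  data LetterSuffix (s : List A) : Set where
    letter-suffix : ∀ a P → h a ≡ P ++ s → s ≢ [] → LetterSuffix s

  data ImageSuffix (K : List A) : Set where
    image-suffix : ∀ W X → H W ≡ X ++ K → ImageSuffix K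

  data HeadFragment : List T → List A → Set where
    empty  : ∀ {rest} → HeadFragment rest []
    proper : ∀ {c rest p r} → h c ≡ p ++ r → r ≢ [] → HeadFragment (c ∷ rest) p

  prefix-of-image : ∀ w {f S} → H w ≡ f ++ S →
    Σ (List T) λ Z → Σ (List T) λ rest → Σ (List A) λ p →
      (w ≡ Z ++ rest) × (f ≡ H Z ++ p) × HeadFragment rest p
  prefix-of-image w {f} {[]} eq =
    w , [] , [] , sym (++-identityʳ w) , trans (sym (++-identityʳ f)) (trans (sym eq) (sym (++-identityʳ (H w)))) , empty
  prefix-of-image w {S = x ∷ S} eq with cut-image w eq (λ ())
  ... | cut w₁ c w₂ p s w≡ hc s≢[] f≡ _ = w₁ , c ∷ w₂ , p , w≡ , f≡ , proper hc s≢[]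

  fragment-cover : ∀ {rest p} → HeadFragment rest p →
    Σ (List T) λ tk → Σ (List T) λ rest′ → Σ (List A) λ r →
      (rest ≡ tk ++ rest′) × (H tk ≡ p ++ r) × (length tk ≤ 1)
  fragment-cover {rest} empty              = [] , rest , [] , refl , refl , z≤n
  fragment-cover (proper {c} {rest} hc _) = c ∷ [] , rest , _ , refl , trans (++-identityʳ (h c)) hc , s≤s z≤n

  image-from : ∀ {a K} P s w → h a ≡ P ++ s → s ++ H w ≡ K → H (a ∷ w) ≡ P ++ K
  image-from P s w ha eq = trans (cong (_++ _) ha) (trans (++-assoc P s _) (cong (P ++_) eq))

module PrefixCode {A : Set} (h : T → List A)
  (injective : ∀ a b → h a ≡ h b → a ≡ b)
  (prefix-free : ∀ a b w → h a ++ w ≡ h b → w ≡ [])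
  where
  open Morphism h

  private
    overshoot : ∀ x xs {p q c r} → (h x ++ H xs) ++ p ≡ q → h c ≡ q ++ r → p ≡ [] × r ≡ []
    overshoot x xs {p} {q} {c} {r} eq hc =
      let rest≡[] = prefix-free x c (H xs ++ p ++ r) (begin
            h x ++ H xs ++ p ++ r    ≡⟨ cong (h x ++_) (++-assoc (H xs) p r) ⟨
            h x ++ (H xs ++ p) ++ r  ≡⟨ ++-assoc (h x) (H xs ++ p) r ⟨
            (h x ++ H xs ++ p) ++ r  ≡⟨ cong (_++ r) (trans (sym (++-assoc (h x) (H xs) p)) eq) ⟩
            q ++ r                   ≡⟨ hc ⟨
            h c                      ∎)
          p++r≡[] = ++-conicalʳ (H xs) _ rest≡[]
      in ++-conicalˡ p r p++r≡[] , ++-conicalʳ p r p++r≡[]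
      where open ≡-Reasoning

  -- The side condition excludes reading an empty prefix on one side as a whole letter image on the other.
  decode-left : ∀ xs ys {p p′ c c′ r r′} → H xs ++ p ≡ H ys ++ p′ → h c ≡ p ++ r → h c′ ≡ p′ ++ r′ →
    (r ≢ [] × r′ ≢ []) ⊎ (p ≢ [] × p′ ≢ []) → xs ≡ ys × p ≡ p′
  decode-left []       []       eq _  _   _                  = refl , eq
  decode-left (x ∷ xs) []       eq _  hc′ (inj₁ (_ , r′≢[])) = ⊥-elim (r′≢[] (proj₂ (overshoot x xs eq hc′)))
  decode-left (x ∷ xs) []       eq _  hc′ (inj₂ (p≢[] , _))  = ⊥-elim (p≢[] (proj₁ (overshoot x xs eq hc′)))
  decode-left []       (y ∷ ys) eq hc _   (inj₁ (r≢[] , _))  = ⊥-elim (r≢[] (proj₂ (overshoot y ys (sym eq) hc)))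
  decode-left []       (y ∷ ys) eq hc _   (inj₂ (_ , p′≢[])) = ⊥-elim (p′≢[] (proj₁ (overshoot y ys (sym eq) hc)))
  decode-left (x ∷ xs) (y ∷ ys) {p} {p′} eq hc hc′ side
    with ++-equidivisible (h x) (H xs ++ p) (h y) (H ys ++ p′)
           (trans (sym (++-assoc (h x) (H xs) p)) (trans eq (++-assoc (h y) (H ys) p′)))
  ... | inj₂ (z , e , hx≡ , _) with () ← prefix-free y x (z ∷ e) (sym hx≡)
  ... | inj₁ (e , hy≡hxe , tails≡) with prefix-free x y e (sym hy≡hxe)
  ...   | refl with injective x y (trans (sym (++-identityʳ (h x))) (sym hy≡hxe))
  ...     | refl with decode-left xs ys tails≡ hc hc′ side
  ...       | refl , p≡p′ = refl , p≡p′

module SuffixCode {A : Set} (h : T → List A)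
  (injective : ∀ a b → h a ≡ h b → a ≡ b)
  (suffix-free : ∀ a b u → u ++ h a ≡ h b → u ≡ [])
  where
  open Morphism h

  private
    hʳ : T → List A
    hʳ a = reverse (h a)

    module Hʳ = Morphism hʳ

    reverse-H : ∀ xs → reverse (H xs) ≡ Hʳ.H (reverse xs)
    reverse-H []       = refl
    reverse-H (x ∷ xs) = begin
      reverse (h x ++ H xs)                 ≡⟨ reverse-++ (h x) (H xs) ⟩
      reverse (H xs) ++ hʳ x                ≡⟨ cong (_++ hʳ x) (reverse-H xs) ⟩
      Hʳ.H (reverse xs) ++ hʳ x             ≡⟨ cong (Hʳ.H (reverse xs) ++_) (++-identityʳ (hʳ x)) ⟨
      Hʳ.H (reverse xs) ++ Hʳ.H (x ∷ [])    ≡⟨ Hʳ.H-++ (reverse xs) (x ∷ []) ⟨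
      Hʳ.H (reverse xs ∷ʳ x)                ≡⟨ cong Hʳ.H (unfold-reverse x xs) ⟨
      Hʳ.H (reverse (x ∷ xs))               ∎
      where open ≡-Reasoning

    prefix-freeʳ : ∀ a b w → hʳ a ++ w ≡ hʳ b → w ≡ []
    prefix-freeʳ a b w eq = reverse-injective (suffix-free a b (reverse w) (begin
      reverse w ++ h a                   ≡⟨ cong (reverse w ++_) (reverse-involutive (h a)) ⟨
      reverse w ++ reverse (hʳ a)        ≡⟨ reverse-++ (hʳ a) w ⟨
      reverse (hʳ a ++ w)                ≡⟨ cong reverse eq ⟩
      reverse (hʳ b)                     ≡⟨ reverse-involutive (h b) ⟩
      h b                                ∎))
      where open ≡-Reasoning

    open PrefixCode hʳ (λ a b → injective a b ∘ reverse-injective) prefix-freeʳ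

  decode-right : ∀ xs ys {s s′} → s ++ H xs ≡ s′ ++ H ys → LetterSuffix s → LetterSuffix s′ → xs ≡ ys × s ≡ s′
  decode-right xs ys {s} {s′} eq (letter-suffix a P ha s≢[]) (letter-suffix b Q hb s′≢[]) =
    let reversed : Hʳ.H (reverse xs) ++ reverse s ≡ Hʳ.H (reverse ys) ++ reverse s′
        reversed = begin
          Hʳ.H (reverse xs) ++ reverse s  ≡⟨ cong (_++ reverse s) (reverse-H xs) ⟨
          reverse (H xs) ++ reverse s     ≡⟨ reverse-++ s (H xs) ⟨
          reverse (s ++ H xs)             ≡⟨ cong reverse eq ⟩
          reverse (s′ ++ H ys)            ≡⟨ reverse-++ s′ (H ys) ⟩
          reverse (H ys) ++ reverse s′    ≡⟨ cong (_++ reverse s′) (reverse-H ys) ⟩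
          Hʳ.H (reverse ys) ++ reverse s′ ∎
        reversed-image : ∀ {c} (R t : List A) → h c ≡ R ++ t → hʳ c ≡ reverse t ++ reverse R
        reversed-image R t hc = trans (cong reverse hc) (reverse-++ R t)
        nonempty : ∀ {t : List A} → t ≢ [] → reverse t ≢ []
        nonempty t≢[] eq = t≢[] (trans (sym (reverse-involutive _)) (cong reverse eq))
        (xs≡ys , s≡s′) = decode-left (reverse xs) (reverse ys) reversed (reversed-image P s ha) (reversed-image Q s′ hb)
                           (inj₂ (nonempty s≢[] , nonempty s′≢[]))
    in reverse-injective xs≡ys , reverse-injective s≡s′
    where open ≡-Reasoning

-- A squarefreeness criterion for images

Overlap : {A : Set} → (T → List A) → T → T → T → Set
Overlap {A} h a b c = Σ (List A) λ u → Σ (List A) λ v → Σ (List A) λ z → Σ (List A) λ w →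
  (h a ≡ u ++ v) × (h b ≡ z ++ v) × (h c ≡ z ++ w) × (v ≢ w) × (u ≢ z)

0Z1Z0 : List T → List T
0Z1Z0 Z = zero ∷ Z ++ suc zero ∷ Z ++ zero ∷ []

p010 p212 : List T
p010 = zero ∷ suc zero ∷ zero ∷ []
p212 = suc (suc zero) ∷ suc zero ∷ suc (suc zero) ∷ []

module Criterion {A : Set} (h : T → List A)
  (nonerasing : ∀ a → h a ≢ [])
  (injective : ∀ a b → h a ≡ h b → a ≡ b)
  (prefix-free : ∀ a b w → h a ++ w ≡ h b → w ≡ [])
  (suffix-free : ∀ a b u → u ++ h a ≡ h b → u ≡ [])
  (overlap⇒010 : ∀ a b c → Overlap h a b c → (a ≡ zero) × (b ≡ suc zero) × (c ≡ zero))
  (Sync : T → Set)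
  (sync? : ∀ a → Dec (Sync a))
  (synchronizing : ∀ {a} → Sync a → ∀ W X M → morph h W ≡ X ++ h a ++ M → Σ (List T) λ y → M ≡ morph h y)
  where
  open Morphism h
  open PrefixCode h injective prefix-free
  open SuffixCode h injective suffix-free
  open import Algebra.Solver.Monoid (++-monoid A) using (solve; _⊜_; _⊕_) renaming (id to ε)
  open ≡-Reasoning

  private
    variable
      a₀ b : T
      w Z W rest u : List T
      s p : List A

  record Admissible (w : List T) : Set where
    field
      squarefree              : SquareFree w
      no-0Z1Z0                : ∀ Z → ¬ Factor (0Z1Z0 Z) w
      short-images-squarefree : ∀ {u} → Factor u w → length u ≤ 5 → SquareFree (H u)
      pairs-synchronize       : ∀ {a b} → Factor (a ∷ b ∷ []) w → Sync a ⊎ Sync b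

  open Admissible

  admissible-factor : Factor u w → Admissible w → Admissible u
  admissible-factor F adm = record
    { squarefree              = squarefree-factor F (squarefree adm)
    ; no-0Z1Z0                = λ Z F′ → no-0Z1Z0 adm Z (factor-trans F′ F)
    ; short-images-squarefree = λ F′ → short-images-squarefree adm (factor-trans F′ F)
    ; pairs-synchronize       = λ F′ → pairs-synchronize adm (factor-trans F′ F)
    }

  HasSync : List T → Set
  HasSync Z = Σ (List T) λ Zₗ → Σ T λ z → Σ (List T) λ Zᵣ → (Z ≡ Zₗ ++ z ∷ Zᵣ) × Sync z

  sync-or-short : Admissible Z → HasSync Z ⊎ length Z ≤ 1
  sync-or-short {[]}         _ = inj₂ z≤n
  sync-or-short {a ∷ []}     _ with sync? a
  ... | yes sa = inj₁ ([] , a , [] , refl , sa)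
  ... | no  _  = inj₂ (s≤s z≤n)
  sync-or-short {a ∷ b ∷ Z} adm with pairs-synchronize adm ([] , Z , refl)
  ... | inj₁ sa = inj₁ ([] , a , b ∷ Z , refl , sa)
  ... | inj₂ sb = inj₁ (a ∷ [] , b , Z , refl , sb)

  image-extends : ∀ {Z R} → HasSync Z → ImageSuffix (H Z ++ R) → Σ (List T) λ Z′ → H Z ++ R ≡ H Z′
  image-extends {R = R} (Zₗ , z , Zᵣ , refl , sz) (image-suffix W X eq)
    with synchronizing sz W (X ++ H Zₗ) (H Zᵣ ++ R) (begin
      H W                                ≡⟨ eq ⟩
      X ++ H (Zₗ ++ z ∷ Zᵣ) ++ R         ≡⟨ cong (λ t → X ++ t ++ R) (H-++ Zₗ (z ∷ Zᵣ)) ⟩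
      X ++ (H Zₗ ++ h z ++ H Zᵣ) ++ R    ≡⟨ solve 5 (λ X l z r R → X ⊕ ((l ⊕ (z ⊕ r)) ⊕ R) ⊜
                                                             (X ⊕ l) ⊕ (z ⊕ (r ⊕ R)))
                                                  refl X (H Zₗ) (h z) (H Zᵣ) R ⟩
      (X ++ H Zₗ) ++ h z ++ H Zᵣ ++ R    ∎)
  ... | y , Hy = Zₗ ++ z ∷ y , (begin
      H (Zₗ ++ z ∷ Zᵣ) ++ R              ≡⟨ cong (_++ R) (H-++ Zₗ (z ∷ Zᵣ)) ⟩
      (H Zₗ ++ h z ++ H Zᵣ) ++ R         ≡⟨ solve 4 (λ l z r R → (l ⊕ (z ⊕ r)) ⊕ R ⊜ l ⊕ (z ⊕ (r ⊕ R)))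
                                                  refl (H Zₗ) (h z) (H Zᵣ) R ⟩
      H Zₗ ++ h z ++ H Zᵣ ++ R           ≡⟨ cong (λ t → H Zₗ ++ h z ++ t) Hy ⟩
      H Zₗ ++ h z ++ H y                 ≡⟨ H-++ Zₗ (z ∷ y) ⟨
      H (Zₗ ++ z ∷ y)                    ∎)

  -- The synchronizing letter in Z makes H Z ++ R an image, so both sides are right decodings of K.
  offsets-agree : ∀ {Z K R s s′} → HasSync Z → ImageSuffix K → K ≡ s ++ H Z ++ R → ∀ V → K ≡ s′ ++ H V →
    LetterSuffix s → LetterSuffix s′ → s ≡ s′
  offsets-agree {Z} {K} {R} {s} hs (image-suffix W X HW) K₁ V K₂ sufs sufs′
    with image-extends hs (image-suffix W (X ++ s) (trans HW (trans (cong (X ++_) K₁) (sym (++-assoc X s _)))))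
  ... | Z′ , eq = proj₂ (decode-right Z′ V (trans (cong (s ++_) (sym eq)) (trans (sym K₁) K₂)) sufs sufs′)

  fragment-proper : HeadFragment rest p → Σ T λ c → Σ (List A) λ r → (h c ≡ p ++ r) × (r ≢ [])
  fragment-proper empty           = zero , h zero , refl , nonerasing zero
  fragment-proper (proper hc r≢[]) = _ , _ , hc , r≢[]

  short-prefix : Admissible W → ∀ u → W ≡ u ++ rest → length u ≤ 5 → SquareFree (H u)
  short-prefix {rest = rest} adm u refl = short-images-squarefree adm (prefix-factor u rest)

  aligned-copies : ∀ Z P → Admissible (a₀ ∷ Z ++ b ∷ Z ++ rest) →
    h a₀ ≡ P ++ s → h b ≡ p ++ s → HeadFragment rest p → ⊥
  aligned-copies {a₀ = a₀} {b = b} {rest = rest} {s = s} {p = p} Z P adm ha hb = go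
    where
    a₀≢b : a₀ ≢ b
    a₀≢b refl = square⇒¬squarefree (a₀ ∷ Z) (λ ())
      ([] , rest , cong (a₀ ∷_) (sym (++-assoc Z (a₀ ∷ Z) rest))) (squarefree adm)

    go : HeadFragment rest p → ⊥
    go empty = a₀≢b (injective a₀ b (trans ha (trans (cong (_++ s) P≡[]) (sym hb))))
      where P≡[] = suffix-free b a₀ P (trans (cong (P ++_) hb) (sym ha))
    go (proper {c} {rest′} {r = r} hc _) with overlap⇒010 a₀ b c (P , s , p , r , ha , hb , hc , s≢r , P≢p)
      where
      b≢c : b ≢ c
      b≢c refl = square⇒¬squarefree (Z ++ b ∷ []) (λ e → case (++-conicalʳ Z _ e) of λ ())
        (a₀ ∷ [] , rest′ , cong (a₀ ∷_)
          (Tˢ.solve 3 (λ Z b r → Z Tˢ.⊕ (b Tˢ.⊕ (Z Tˢ.⊕ (b Tˢ.⊕ r))) Tˢ.⊜ ((Z Tˢ.⊕ b) Tˢ.⊕ (Z Tˢ.⊕ b)) Tˢ.⊕ r)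
            refl Z (b ∷ []) rest′))
        (squarefree adm)
      s≢r : s ≢ r
      s≢r s≡r = b≢c (injective b c (trans hb (trans (cong (p ++_) s≡r) (sym hc))))
      P≢p : P ≢ p
      P≢p P≡p = a₀≢b (injective a₀ b (trans ha (trans (cong (_++ s) P≡p) (sym hb))))
    ... | refl , refl , refl = no-0Z1Z0 adm Z ([] , rest′ , cong (zero ∷_)
          (Tˢ.solve 4 (λ Z o z r → Z Tˢ.⊕ (o Tˢ.⊕ (Z Tˢ.⊕ (z Tˢ.⊕ r))) Tˢ.⊜
                                   (Z Tˢ.⊕ (o Tˢ.⊕ (Z Tˢ.⊕ z))) Tˢ.⊕ r)
            refl Z (suc zero ∷ []) (zero ∷ []) rest′))

  square-inside-letter : Admissible (a₀ ∷ w) → ∀ P Y r → Y ≢ [] → h a₀ ≡ P ++ Y ++ Y ++ r → ⊥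
  square-inside-letter {a₀ = a₀} adm P Y r Y≢[] ha =
    short-prefix adm (a₀ ∷ []) refl (s≤s z≤n) (P , Y , r , Y≢[] , trans (++-identityʳ (h a₀)) ha)

  copies-start-in-same-letter : ∀ Z rest → Admissible (a₀ ∷ Z ++ rest) → ∀ P Y e p S →
    h a₀ ≡ P ++ Y ++ e → e ≢ [] → Y ≢ [] → HeadFragment rest p →
    Y ≡ e ++ H Z ++ p → e ++ H (Z ++ rest) ≡ Y ++ S → ⊥
  copies-start-in-same-letter {a₀ = a₀} Z rest adm P Y e p S ha e≢[] Y≢[] frag Y≡ tail
    with sync-or-short (admissible-factor (a₀ ∷ [] , rest , refl) adm)
  ... | inj₁ hs = Y≢[] (++-identityˡ-unique Y e≡Ye)
    where
    first : (Y ++ e) ++ H (Z ++ rest) ≡ Y ++ Y ++ S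
    first = trans (++-assoc Y e _) (cong (Y ++_) tail)
    e≡Ye : e ≡ Y ++ e
    e≡Ye = offsets-agree hs (image-suffix (a₀ ∷ Z ++ rest) P (image-from P (Y ++ e) (Z ++ rest) ha first))
             (++-extendʳ e (H Z) p (Y ++ S) Y≡) (Z ++ rest) (sym first)
             (letter-suffix a₀ (P ++ Y) (trans ha (sym (++-assoc P Y e))) e≢[])
             (letter-suffix a₀ P ha (λ Ye≡[] → e≢[] (++-conicalʳ Y e Ye≡[])))
  ... | inj₂ short with fragment-cover frag
  ...   | tk , rest′ , r , refl , Htk , l =
    short-prefix adm (a₀ ∷ Z ++ tk) (cong (a₀ ∷_) (sym (++-assoc Z tk rest′)))
      (≤-trans (length-++-≤ (a₀ ∷ Z) (s≤s short) l) 3≤5)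
      (P , Y , r , Y≢[] , (begin
        h a₀ ++ H (Z ++ tk)            ≡⟨ cong₂ _++_ ha (trans (H-++ Z tk) (cong (H Z ++_) Htk)) ⟩
        (P ++ Y ++ e) ++ H Z ++ p ++ r ≡⟨ solve 6 (λ P Y e z p r → (P ⊕ (Y ⊕ e)) ⊕ (z ⊕ (p ⊕ r)) ⊜
                                                                P ⊕ (Y ⊕ ((e ⊕ (z ⊕ p)) ⊕ r)))
                                                  refl P Y e (H Z) p r ⟩
        P ++ Y ++ (e ++ H Z ++ p) ++ r ≡⟨ cong (λ t → P ++ Y ++ t ++ r) Y≡ ⟨
        P ++ Y ++ Y ++ r               ∎))
    where 3≤5 = s≤s (s≤s (s≤s z≤n))

  second-copy-inside-letter : ∀ Z b w → Admissible (a₀ ∷ Z ++ b ∷ w) → ∀ P s p Y f S → h a₀ ≡ P ++ s → s ≢ [] →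
    h b ≡ p ++ Y ++ f → f ≢ [] → Y ≢ [] → Y ≡ s ++ H Z ++ p →
    s ++ H (Z ++ b ∷ w) ≡ Y ++ Y ++ S → Y ++ S ≡ (Y ++ f) ++ H w → ⊥
  second-copy-inside-letter {a₀ = a₀} Z b w adm P s p Y f S ha s≢[] hb f≢[] Y≢[] Y≡ first second
    with sync-or-short (admissible-factor (a₀ ∷ [] , b ∷ w , refl) adm)
  ... | inj₁ hs = f≢[] (++-conicalˡ f _ (++-identityʳ-unique Y Y≡Y++rest))
    where
    s≡Yf : s ≡ Y ++ f
    s≡Yf = offsets-agree hs
      (image-suffix (a₀ ∷ Z ++ b ∷ w) (P ++ Y) (trans (image-from P s (Z ++ b ∷ w) ha first) (sym (++-assoc P Y _))))
      (++-extendʳ s (H Z) p S Y≡) w second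
      (letter-suffix a₀ P ha s≢[]) (letter-suffix b p hb (λ Yf≡[] → f≢[] (++-conicalʳ Y f Yf≡[])))
    Y≡Y++rest : Y ≡ Y ++ f ++ H Z ++ p
    Y≡Y++rest = trans Y≡ (trans (cong (_++ H Z ++ p) s≡Yf) (++-assoc Y f _))
  ... | inj₂ short =
    short-prefix adm (a₀ ∷ Z ++ b ∷ []) (cong (a₀ ∷_) (sym (++-assoc Z (b ∷ []) w)))
      (≤-trans (length-++-≤ (a₀ ∷ Z) (s≤s short) (s≤s z≤n)) 3≤5)
      (P , Y , f ++ [] , Y≢[] , (begin
        h a₀ ++ H (Z ++ b ∷ [])                ≡⟨ cong₂ _++_ ha
                                                     (trans (H-++ Z (b ∷ [])) (cong (λ t → H Z ++ t ++ []) hb)) ⟩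
        (P ++ s) ++ H Z ++ (p ++ Y ++ f) ++ [] ≡⟨ solve 6 (λ P s z p Y f → (P ⊕ s) ⊕ (z ⊕ ((p ⊕ (Y ⊕ f)) ⊕ ε)) ⊜
                                                                   P ⊕ ((s ⊕ (z ⊕ p)) ⊕ (Y ⊕ (f ⊕ ε))))
                                                          refl P s (H Z) p Y f ⟩
        P ++ (s ++ H Z ++ p) ++ Y ++ f ++ []   ≡⟨ cong (λ t → P ++ t ++ Y ++ f ++ []) Y≡ ⟨
        P ++ Y ++ Y ++ f ++ []                 ∎))
    where 3≤5 = s≤s (s≤s (s≤s z≤n))

  module CopiesStartInDistinctLetters (a₀ b : T) (Z₁ Z₂ rest : List T) (P s p′ s′ p Y S : List A)
    (adm : Admissible (a₀ ∷ Z₁ ++ b ∷ Z₂ ++ rest))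
    (ha : h a₀ ≡ P ++ s) (s≢[] : s ≢ []) (hb : h b ≡ p′ ++ s′) (s′≢[] : s′ ≢ [])
    (frag : HeadFragment rest p) (Y≢[] : Y ≢ [])
    (Y₁ : Y ≡ s ++ H Z₁ ++ p′) (Y₂ : Y ≡ s′ ++ H Z₂ ++ p)
    (first : s ++ H (Z₁ ++ b ∷ Z₂ ++ rest) ≡ Y ++ Y ++ S) (second : Y ++ S ≡ s′ ++ H (Z₂ ++ rest))
    where

    private
      word : List T
      word = a₀ ∷ Z₁ ++ b ∷ Z₂ ++ rest

      image : H word ≡ P ++ Y ++ Y ++ S
      image = image-from P s (Z₁ ++ b ∷ Z₂ ++ rest) ha first

      short-cover : length Z₁ ≤ 1 → length Z₂ ≤ 1 → ⊥
      short-cover short₁ short₂ with fragment-cover frag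
      ... | tk , rest′ , r , rest≡ , Htk , l =
        short-prefix adm (a₀ ∷ Z₁ ++ b ∷ Z₂ ++ tk)
          (cong (a₀ ∷_) (trans (cong (λ t → Z₁ ++ b ∷ Z₂ ++ t) rest≡)
            (Tˢ.solve 5 (λ Z₁ b Z₂ t r → Z₁ Tˢ.⊕ (b Tˢ.⊕ (Z₂ Tˢ.⊕ (t Tˢ.⊕ r))) Tˢ.⊜
                                          (Z₁ Tˢ.⊕ (b Tˢ.⊕ (Z₂ Tˢ.⊕ t))) Tˢ.⊕ r)
              refl Z₁ (b ∷ []) Z₂ tk rest′)))
          (length-++-≤ (a₀ ∷ Z₁) (s≤s short₁) (length-++-≤ (b ∷ Z₂) (s≤s short₂) l))
          (P , Y , r , Y≢[] , (begin
            h a₀ ++ H (Z₁ ++ b ∷ Z₂ ++ tk)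
              ≡⟨ cong (h a₀ ++_) (trans (H-++ Z₁ _) (cong (λ t → H Z₁ ++ h b ++ t) (H-++ Z₂ tk))) ⟩
            h a₀ ++ H Z₁ ++ h b ++ H Z₂ ++ H tk
              ≡⟨ cong₂ (λ t t′ → t ++ H Z₁ ++ t′ ++ H Z₂ ++ H tk) ha hb ⟩
            (P ++ s) ++ H Z₁ ++ (p′ ++ s′) ++ H Z₂ ++ H tk
              ≡⟨ cong (λ t → (P ++ s) ++ H Z₁ ++ (p′ ++ s′) ++ H Z₂ ++ t) Htk ⟩
            (P ++ s) ++ H Z₁ ++ (p′ ++ s′) ++ H Z₂ ++ p ++ r   ≡⟨ solve 8 (λ P s z₁ p′ s′ z₂ p r →
                                                                     (P ⊕ s) ⊕ (z₁ ⊕ ((p′ ⊕ s′) ⊕ (z₂ ⊕ (p ⊕ r)))) ⊜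
                                                                     P ⊕ ((s ⊕ (z₁ ⊕ p′)) ⊕ ((s′ ⊕ (z₂ ⊕ p)) ⊕ r)))
                                                                   refl P s (H Z₁) p′ s′ (H Z₂) p r ⟩
            P ++ (s ++ H Z₁ ++ p′) ++ (s′ ++ H Z₂ ++ p) ++ r   ≡⟨ cong₂ (λ t t′ → P ++ t ++ t′ ++ r) Y₁ Y₂ ⟨
            P ++ Y ++ Y ++ r                                   ∎))

    offsets-equal : s ≡ s′
    offsets-equal with sync-or-short (admissible-factor (a₀ ∷ [] , b ∷ Z₂ ++ rest , refl) adm)
    ... | inj₁ hs = offsets-agree hs (image-suffix word (P ++ Y) (trans image (sym (++-assoc P Y _))))
                      (++-extendʳ s (H Z₁) p′ S Y₁) (Z₂ ++ rest) second
                      (letter-suffix a₀ P ha s≢[]) (letter-suffix b p′ hb s′≢[])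
    ... | inj₂ short₁ with sync-or-short (admissible-factor Z₂-factor adm)
      where
      Z₂-factor : Factor Z₂ word
      Z₂-factor = a₀ ∷ Z₁ ++ b ∷ [] , rest , cong (a₀ ∷_) (sym (++-assoc Z₁ (b ∷ []) (Z₂ ++ rest)))
    ...   | inj₁ hs = sym (offsets-agree hs (image-suffix word P image)
                        (++-extendʳ s′ (H Z₂) p (Y ++ S) Y₂) (Z₁ ++ b ∷ Z₂ ++ rest) (sym first)
                        (letter-suffix b p′ hb s′≢[]) (letter-suffix a₀ P ha s≢[]))
    ...   | inj₂ short₂ = ⊥-elim (short-cover short₁ short₂)

    impossible : ⊥
    impossible with fragment-proper frag
    ... | c , r , hc , r≢[] with decode-left Z₁ Z₂ HZ hb hc (inj₁ (s′≢[] , r≢[]))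
      where
      HZ : H Z₁ ++ p′ ≡ H Z₂ ++ p
      HZ = ++-cancelˡ s _ _ (trans (sym Y₁) (trans Y₂ (cong (_++ H Z₂ ++ p) (sym offsets-equal))))
    ... | Z₁≡Z₂ , p′≡p =
      aligned-copies Z₁ P (subst (λ Z → Admissible (a₀ ∷ Z₁ ++ b ∷ Z ++ rest)) (sym Z₁≡Z₂) adm) ha
        (trans hb (cong₂ _++_ p′≡p (sym offsets-equal))) frag

  no-square-starting-in-letter : ∀ {a₀} w P s Y S → Admissible (a₀ ∷ w) → h a₀ ≡ P ++ s → s ≢ [] → Y ≢ [] →
    s ++ H w ≡ Y ++ Y ++ S → ⊥
  no-square-starting-in-letter {a₀} w P s Y S adm ha s≢[] Y≢[] eq with ++-equidivisible s (H w) Y (Y ++ S) eq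
  ... | inj₁ (e , refl , Hw≡) with cut-image w {e} Hw≡ (λ YS≡[] → Y≢[] (++-conicalˡ Y S YS≡[]))
  ...   | cut Z₁ b w₃ p′ s′ refl hb s′≢[] refl second with ++-equidivisible s′ (H w₃) Y S (sym second)
  ...     | inj₁ (f , Y≡s′f , Hw₃≡) with prefix-of-image w₃ {f} Hw₃≡
  ...       | Z₂ , rest , p , refl , refl , frag =
              CopiesStartInDistinctLetters.impossible a₀ b Z₁ Z₂ rest P s p′ s′ p Y S
                adm ha s≢[] hb s′≢[] frag Y≢[] refl Y≡s′f eq second
  no-square-starting-in-letter {a₀} w P s Y S adm ha s≢[] Y≢[] eq
    | inj₁ (e , refl , Hw≡) | cut Z₁ b w₃ p′ s′ refl hb s′≢[] refl second | inj₂ (x , f , refl , _) =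
              second-copy-inside-letter Z₁ b w₃ adm P s p′ Y (x ∷ f) S ha s≢[] hb (λ ()) Y≢[] refl eq second
  no-square-starting-in-letter w P s Y S adm ha s≢[] Y≢[] eq | inj₂ (x , e , refl , tail)
    with ++-equidivisible (x ∷ e) (H w) Y S (sym tail)
  ... | inj₁ (f , Y≡ , Hw≡) with prefix-of-image w {f} Hw≡
  ...   | Z , rest , p , refl , refl , frag =
          copies-start-in-same-letter Z rest adm P Y (x ∷ e) p S ha (λ ()) Y≢[] frag Y≡ (sym tail)
  no-square-starting-in-letter w P s Y S adm ha s≢[] Y≢[] eq | inj₂ (x , e , refl , tail) | inj₂ (y , f , xe≡ , _) =
          square-inside-letter adm P Y (y ∷ f) Y≢[] (trans ha (cong (λ t → P ++ Y ++ t) xe≡))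

  image-squarefree : ∀ {w} → Admissible w → SquareFree (H w)
  image-squarefree {w} adm (L , Y , S , Y≢[] , eq) with cut-image w {L} eq (λ YYS≡[] → Y≢[] (++-conicalˡ Y _ YYS≡[]))
  ... | cut w₁ a₀ w₂ P s refl ha s≢[] _ YYS≡ =
    no-square-starting-in-letter w₂ P s Y S (admissible-factor (suffix-factor w₁ (a₀ ∷ w₂)) adm) ha s≢[] Y≢[] (sym YYS≡)

-- The morphism τ

open Morphism τ using () renaming (H to Hτ; H-++ to Hτ-++; H-nonempty to Hτ-nonempty)

τ-nonerasing : ∀ a → τ a ≢ []
τ-nonerasing zero             ()
τ-nonerasing (suc zero)       ()
τ-nonerasing (suc (suc zero)) ()

τ-injective : ∀ a b → τ a ≡ τ b → a ≡ b
τ-injective zero             zero             _  = refl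
τ-injective (suc zero)       (suc zero)       _  = refl
τ-injective (suc (suc zero)) (suc (suc zero)) _  = refl
τ-injective zero             (suc zero)       ()
τ-injective zero             (suc (suc zero)) ()
τ-injective (suc zero)       zero             ()
τ-injective (suc zero)       (suc (suc zero)) ()
τ-injective (suc (suc zero)) zero             ()
τ-injective (suc (suc zero)) (suc zero)       ()

-- The constructor name shows where the image of the letter is cut.
data τ-Split : T → List T → List T → Set where
  ·012 : τ-Split zero [] (zero ∷ suc zero ∷ suc (suc zero) ∷ [])
  0·12 : τ-Split zero (zero ∷ []) (suc zero ∷ suc (suc zero) ∷ [])
  01·2 : τ-Split zero (zero ∷ suc zero ∷ []) (suc (suc zero) ∷ [])
  012· : τ-Split zero (zero ∷ suc zero ∷ suc (suc zero) ∷ []) []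
  ·02  : τ-Split (suc zero) [] (zero ∷ suc (suc zero) ∷ [])
  0·2  : τ-Split (suc zero) (zero ∷ []) (suc (suc zero) ∷ [])
  02·  : τ-Split (suc zero) (zero ∷ suc (suc zero) ∷ []) []
  ·1   : τ-Split (suc (suc zero)) [] (suc zero ∷ [])
  1·   : τ-Split (suc (suc zero)) (suc zero ∷ []) []

τ-split : ∀ a u v → τ a ≡ u ++ v → τ-Split a u v
τ-split zero             []                    _ refl = ·012
τ-split zero             (_ ∷ [])              _ refl = 0·12
τ-split zero             (_ ∷ _ ∷ [])          _ refl = 01·2
τ-split zero             (_ ∷ _ ∷ _ ∷ [])      _ refl = 012·
τ-split zero             (_ ∷ _ ∷ _ ∷ _ ∷ _)   _ ()
τ-split (suc zero)       []                    _ refl = ·02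
τ-split (suc zero)       (_ ∷ [])              _ refl = 0·2
τ-split (suc zero)       (_ ∷ _ ∷ [])          _ refl = 02·
τ-split (suc zero)       (_ ∷ _ ∷ _ ∷ _)       _ ()
τ-split (suc (suc zero)) []                    _ refl = ·1
τ-split (suc (suc zero)) (_ ∷ [])              _ refl = 1·
τ-split (suc (suc zero)) (_ ∷ _ ∷ _)           _ ()

τ-prefix-free : ∀ a b w → τ a ++ w ≡ τ b → w ≡ []
τ-prefix-free a b w eq with τ-split b (τ a) w (sym eq)
τ-prefix-free zero             _ _ _ | 012· = refl
τ-prefix-free (suc zero)       _ _ _ | 02·  = refl
τ-prefix-free (suc (suc zero)) _ _ _ | 1·   = refl

τ-suffix-free : ∀ a b u → u ++ τ a ≡ τ b → u ≡ []
τ-suffix-free a b u eq with τ-split b u (τ a) (sym eq)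
τ-suffix-free zero             _ _ _ | ·012 = refl
τ-suffix-free (suc zero)       _ _ _ | ·02  = refl
τ-suffix-free (suc (suc zero)) _ _ _ | ·1   = refl

τ-cancelˡ : ∀ a b {z r} → τ a ++ z ≡ τ b ++ r → z ≡ r
τ-cancelˡ a b {z} {r} eq with ++-equidivisible (τ a) z (τ b) r eq
... | inj₁ (e , τb≡τae , z≡er) with τ-prefix-free a b e (sym τb≡τae)
...   | refl = z≡er
τ-cancelˡ a b eq | inj₂ (x , e , τa≡ , _) with () ← τ-prefix-free b a (x ∷ e) (sym τa≡)

τ-overlap⇒010 : ∀ a b c → Overlap τ a b c → (a ≡ zero) × (b ≡ suc zero) × (c ≡ zero)
τ-overlap⇒010 a b c (u , v , z , w , τa≡ , τb≡ , τc≡ , v≢w , u≢z) =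
  table (τ-split a u v τa≡) (τ-split b z v τb≡) (τ-split c z w τc≡) v≢w u≢z
  where
  table : ∀ {a b c u v z w} → τ-Split a u v → τ-Split b z v → τ-Split c z w → v ≢ w → u ≢ z →
          (a ≡ zero) × (b ≡ suc zero) × (c ≡ zero)
  table 01·2 0·2  0·12 _   _   = refl , refl , refl
  table ·012 ·012 ·012 v≢w _   = ⊥-elim (v≢w refl)
  table ·012 ·012 ·02  _   u≢z = ⊥-elim (u≢z refl)
  table ·012 ·012 ·1   _   u≢z = ⊥-elim (u≢z refl)
  table 0·12 0·12 0·12 v≢w _   = ⊥-elim (v≢w refl)
  table 0·12 0·12 0·2  _   u≢z = ⊥-elim (u≢z refl)
  table 01·2 01·2 01·2 v≢w _   = ⊥-elim (v≢w refl)
  table 01·2 0·2  0·2  v≢w _   = ⊥-elim (v≢w refl)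
  table 012· 012· 012· v≢w _   = ⊥-elim (v≢w refl)
  table 012· 02·  02·  v≢w _   = ⊥-elim (v≢w refl)
  table 012· 1·   1·   v≢w _   = ⊥-elim (v≢w refl)
  table ·02  ·02  ·012 _   u≢z = ⊥-elim (u≢z refl)
  table ·02  ·02  ·02  v≢w _   = ⊥-elim (v≢w refl)
  table ·02  ·02  ·1   _   u≢z = ⊥-elim (u≢z refl)
  table 0·2  01·2 01·2 v≢w _   = ⊥-elim (v≢w refl)
  table 0·2  0·2  0·12 _   u≢z = ⊥-elim (u≢z refl)
  table 0·2  0·2  0·2  v≢w _   = ⊥-elim (v≢w refl)
  table 02·  012· 012· v≢w _   = ⊥-elim (v≢w refl)
  table 02·  02·  02·  v≢w _   = ⊥-elim (v≢w refl)
  table 02·  1·   1·   v≢w _   = ⊥-elim (v≢w refl)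
  table ·1   ·1   ·012 _   u≢z = ⊥-elim (u≢z refl)
  table ·1   ·1   ·02  _   u≢z = ⊥-elim (u≢z refl)
  table ·1   ·1   ·1   v≢w _   = ⊥-elim (v≢w refl)
  table 1·   012· 012· v≢w _   = ⊥-elim (v≢w refl)
  table 1·   02·  02·  v≢w _   = ⊥-elim (v≢w refl)
  table 1·   1·   1·   v≢w _   = ⊥-elim (v≢w refl)

data τ-Sync : T → Set where
  sync₀ : τ-Sync zero
  sync₁ : τ-Sync (suc zero)

τ-sync? : ∀ a → Dec (τ-Sync a)
τ-sync? zero             = yes sync₀
τ-sync? (suc zero)       = yes sync₁
τ-sync? (suc (suc zero)) = no λ ()

τ-sync-head : ∀ {a} → τ-Sync a → Σ (List T) λ t → τ a ≡ zero ∷ t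
τ-sync-head sync₀ = _ , refl
τ-sync-head sync₁ = _ , refl

τ-inner-suffix-head : ∀ b y X x e → τ b ≡ (y ∷ X) ++ x ∷ e → x ≢ zero
τ-inner-suffix-head b y X x e eq with τ-split b (y ∷ X) (x ∷ e) eq
... | 0·12 = λ ()
... | 01·2 = λ ()
... | 0·2  = λ ()

τ-synchronizing : ∀ {a} → τ-Sync a → ∀ W X M → Hτ W ≡ X ++ τ a ++ M → Σ (List T) λ y → M ≡ Hτ y
τ-synchronizing {a} sa []      X M eq = ⊥-elim (τ-nonerasing a (++-conicalˡ (τ a) M (++-conicalʳ X _ (sym eq))))
τ-synchronizing {a} sa (b ∷ W) X M eq with ++-equidivisible (τ b) (Hτ W) X (τ a ++ M) eq
... | inj₁ (e , refl , eq′) = τ-synchronizing sa W e M eq′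
... | inj₂ (x , e , τb≡ , tail) with X
...   | [] = W , τ-cancelˡ a b (trans tail (cong (_++ Hτ W) (sym τb≡)))
...   | y ∷ X′ with τ-sync-head sa
...     | t , τa≡ =
  ⊥-elim (τ-inner-suffix-head b y X′ x e τb≡ (sym (proj₁ (∷-injective (trans (cong (_++ M) (sym τa≡)) tail)))))

-- Finite checks on short words

module Decide {A : Set} (_≟_ : DecidableEquality A) where

  prefix? : ∀ u w → Dec (Σ (List A) λ z → w ≡ u ++ z)
  prefix? []      w       = yes (w , refl)
  prefix? (a ∷ u) []      = no λ ()
  prefix? (a ∷ u) (b ∷ w) with a ≟ b | prefix? u w
  ... | yes refl | yes (z , eq) = yes (z , cong (a ∷_) eq)
  ... | yes refl | no ¬p        = no λ (z , eq) → ¬p (z , proj₂ (∷-injective eq))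
  ... | no a≢b   | _            = no λ (z , eq) → a≢b (sym (proj₁ (∷-injective eq)))

  split? : (P : List A → List A → Set) → (∀ x y → Dec (P x y)) →
    ∀ w → Dec (Σ (List A) λ x → Σ (List A) λ y → (w ≡ x ++ y) × P x y)
  split? P P? [] = map′ (λ p → [] , [] , refl , p) (λ { ([] , [] , refl , p) → p }) (P? [] [])
  split? P P? (c ∷ w) =
    map′ to from (P? [] (c ∷ w) ⊎-dec split? (λ x → P (c ∷ x)) (λ x → P? (c ∷ x)) w)
    where
    to : _ → _
    to (inj₁ p)                = [] , c ∷ w , refl , p
    to (inj₂ (x , y , eq , p)) = c ∷ x , y , cong (c ∷_) eq , p
    from : _ → _
    from ([]    , _ , refl , p) = inj₁ p
    from (_ ∷ x , y , eq   , p) with ∷-injective eq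
    ... | refl , eq′ = inj₂ (x , y , eq′ , p)

  factor? : ∀ u w → Dec (Factor u w)
  factor? u w = map′
    (λ { (x , _ , refl , z , refl) → x , z , refl })
    (λ { (x , z , refl) → x , u ++ z , refl , z , refl })
    (split? (λ _ r → Σ (List A) λ z → r ≡ u ++ z) (λ _ → prefix? u) w)

  squarefree? : ∀ w → Dec (SquareFree w)
  squarefree? w = ¬? (map′
    (λ { (x , _ , refl , y , _ , refl , y≢[] , z , refl) → x , y , z , y≢[] , refl })
    (λ { (x , y , z , y≢[] , refl) → x , y ++ y ++ z , refl , y , y ++ z , refl , y≢[] , z , refl })
    (split? (λ _ r → Σ (List A) λ y → Σ (List A) λ t → (r ≡ y ++ t) × (y ≢ []) × Σ (List A) λ z → t ≡ y ++ z)
            (λ _ → split? (λ y t → (y ≢ []) × Σ (List A) λ z → t ≡ y ++ z)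
                          (λ y t → ¬? (empty? y) ×-dec prefix? y t))
            w))

words : ℕ → List (List T)
words zero    = [] ∷ []
words (suc n) = map (zero ∷_) (words n) ++ map (suc zero ∷_) (words n) ++ map (suc (suc zero) ∷_) (words n)

∈-words : ∀ u → u ∈ words (length u)
∈-words []                   = here refl
∈-words (zero ∷ u)           = ∈-++⁺ˡ (∈-map⁺ (zero ∷_) (∈-words u))
∈-words (suc zero ∷ u)       = ∈-++⁺ʳ (map (zero ∷_) (words (length u)))
                                 (∈-++⁺ˡ (∈-map⁺ (suc zero ∷_) (∈-words u)))
∈-words (suc (suc zero) ∷ u) = ∈-++⁺ʳ (map (zero ∷_) (words (length u)))
                                 (∈-++⁺ʳ (map (suc zero ∷_) (words (length u))) (∈-map⁺ (suc (suc zero) ∷_) (∈-words u)))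

open Decide (_≟ᶠ_ {3})

τ-KeepsSquarefree : List T → Set
τ-KeepsSquarefree u = SquareFree u → ¬ Factor p010 u → ¬ Factor p212 u → SquareFree (Hτ u)

τ-keeps-squarefree-short : ∀ u → length u ≤ 5 → τ-KeepsSquarefree u
τ-keeps-squarefree-short u l = All.lookup (checked (length u) l) (∈-words u)
  where
  τ-keeps-squarefree? : ∀ u → Dec (τ-KeepsSquarefree u)
  τ-keeps-squarefree? u = squarefree? u →-dec ¬? (factor? p010 u) →-dec ¬? (factor? p212 u) →-dec squarefree? (Hτ u)

  checked : ∀ n → n ≤ 5 → All τ-KeepsSquarefree (words n)
  checked 0 _ = toWitness {a? = all? τ-keeps-squarefree? (words 0)} tt
  checked 1 _ = toWitness {a? = all? τ-keeps-squarefree? (words 1)} tt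
  checked 2 _ = toWitness {a? = all? τ-keeps-squarefree? (words 2)} tt
  checked 3 _ = toWitness {a? = all? τ-keeps-squarefree? (words 3)} tt
  checked 4 _ = toWitness {a? = all? τ-keeps-squarefree? (words 4)} tt
  checked 5 _ = toWitness {a? = all? τ-keeps-squarefree? (words 5)} tt
  checked (suc (suc (suc (suc (suc (suc _)))))) (s≤s (s≤s (s≤s (s≤s (s≤s ())))))

-- Squarefreeness of τ^k(0)

τ-image-avoids-010 : ∀ w → ¬ Factor p010 (Hτ w)
τ-image-avoids-010 []      ([]    , _ , ())
τ-image-avoids-010 []      (_ ∷ _ , _ , ())
τ-image-avoids-010 (b ∷ w) (x , z , eq) with ++-equidivisible (τ b) (Hτ w) x (p010 ++ z) eq
... | inj₁ (e , refl , eq′) = τ-image-avoids-010 w (e , z , eq′)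
... | inj₂ (y , e , τb≡ , tail) with τ-split b x (y ∷ e) τb≡ | tail
...   | ·012 | ()
...   | 0·12 | ()
...   | 01·2 | ()
...   | ·02  | ()
...   | 0·2  | ()
...   | ·1   | ()

τ-image-not-starting-12 : ∀ w {z} → Hτ w ≢ suc zero ∷ suc (suc zero) ∷ z
τ-image-not-starting-12 (suc (suc zero) ∷ zero ∷ _)           ()
τ-image-not-starting-12 (suc (suc zero) ∷ suc zero ∷ _)       ()
τ-image-not-starting-12 (suc (suc zero) ∷ suc (suc zero) ∷ _) ()

τ-image-avoids-212 : ∀ w → ¬ Factor p212 (Hτ w)
τ-image-avoids-212 []      ([]    , _ , ())
τ-image-avoids-212 []      (_ ∷ _ , _ , ())
τ-image-avoids-212 (b ∷ w) (x , z , eq) with ++-equidivisible (τ b) (Hτ w) x (p212 ++ z) eq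
... | inj₁ (e , refl , eq′) = τ-image-avoids-212 w (e , z , eq′)
... | inj₂ (y , e , τb≡ , tail) with τ-split b x (y ∷ e) τb≡ | tail
...   | ·012 | ()
...   | 0·12 | ()
...   | 01·2 | tail′ = τ-image-not-starting-12 w (sym (proj₂ (∷-injective tail′)))
...   | ·02  | ()
...   | 0·2  | tail′ = τ-image-not-starting-12 w (sym (proj₂ (∷-injective tail′)))
...   | ·1   | ()

squarefree-no-0Z1Z0 : ∀ {w} → SquareFree w → ¬ Factor p010 w → ¬ Factor p212 w → ∀ Z → ¬ Factor (0Z1Z0 Z) w
squarefree-no-0Z1Z0 {w} sf no-010 no-212 Z F = by-first-letter Z F
  where
  inside : ∀ Z {u} → Factor (0Z1Z0 Z) w → Factor u (0Z1Z0 Z) → Factor u w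
  inside Z F F′ = factor-trans F′ F

  no-aa : ∀ a → ¬ Factor (a ∷ a ∷ []) w
  no-aa a F′ = square⇒¬squarefree (a ∷ []) (λ ()) F′ sf

  by-last-letter : ∀ Zi t → Factor (0Z1Z0 (suc (suc zero) ∷ Zi ∷ʳ t)) w → ⊥
  by-last-letter Zi zero F = no-aa zero (inside (suc (suc zero) ∷ Zi ∷ʳ zero) F
    (zero ∷ suc (suc zero) ∷ Zi ++ zero ∷ suc zero ∷ suc (suc zero) ∷ Zi , [] ,
    cong (λ t → zero ∷ suc (suc zero) ∷ t)
      (Tˢ.solve 3 (λ Zi z m → (Zi Tˢ.⊕ z) Tˢ.⊕ (m Tˢ.⊕ ((Zi Tˢ.⊕ z) Tˢ.⊕ z)) Tˢ.⊜
                              (Zi Tˢ.⊕ (z Tˢ.⊕ (m Tˢ.⊕ Zi))) Tˢ.⊕ (z Tˢ.⊕ z))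
         refl Zi (zero ∷ []) (suc zero ∷ suc (suc zero) ∷ []))))
  by-last-letter Zi (suc zero) F = no-aa (suc zero) (inside (suc (suc zero) ∷ Zi ∷ʳ suc zero) F
    (zero ∷ suc (suc zero) ∷ Zi , _ , cong (λ t → zero ∷ suc (suc zero) ∷ t) (++-assoc Zi (suc zero ∷ []) _)))
  by-last-letter Zi (suc (suc zero)) F = no-212 (inside (suc (suc zero) ∷ Zi ∷ʳ suc (suc zero)) F
    (zero ∷ suc (suc zero) ∷ Zi , _ , cong (λ t → zero ∷ suc (suc zero) ∷ t) (++-assoc Zi (suc (suc zero) ∷ []) _)))

  by-first-letter : ∀ Z → ¬ Factor (0Z1Z0 Z) w
  by-first-letter []                     F = no-010 F
  by-first-letter (zero ∷ Z)             F = no-aa zero (inside (zero ∷ Z) F ([] , _ , refl))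
  by-first-letter (suc zero ∷ Z)         F =
    no-aa (suc zero) (inside (suc zero ∷ Z) F (zero ∷ suc zero ∷ Z , Z ++ zero ∷ [] , refl))
  by-first-letter (suc (suc zero) ∷ Z)   F with initLast Z
  ... | []       = no-212 (inside (suc (suc zero) ∷ []) F (zero ∷ [] , zero ∷ [] , refl))
  ... | Zi ∷ʳ′ t = by-last-letter Zi t F

module τ-Criterion =
  Criterion τ τ-nonerasing τ-injective τ-prefix-free τ-suffix-free τ-overlap⇒010 τ-Sync τ-sync? τ-synchronizing

squarefree-pairs-τ-sync : ∀ {w} → SquareFree w → ∀ {a b} → Factor (a ∷ b ∷ []) w → τ-Sync a ⊎ τ-Sync b
squarefree-pairs-τ-sync sf {zero}                                _ = inj₁ sync₀
squarefree-pairs-τ-sync sf {suc zero}                            _ = inj₁ sync₁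
squarefree-pairs-τ-sync sf {suc (suc zero)} {zero}               _ = inj₂ sync₀
squarefree-pairs-τ-sync sf {suc (suc zero)} {suc zero}           _ = inj₂ sync₁
squarefree-pairs-τ-sync sf {suc (suc zero)} {suc (suc zero)}     F =
  ⊥-elim (square⇒¬squarefree (suc (suc zero) ∷ []) (λ ()) F sf)

τ-admissible : ∀ {w} → SquareFree w → ¬ Factor p010 w → ¬ Factor p212 w → τ-Criterion.Admissible w
τ-admissible sf no-010 no-212 = record
  { squarefree              = sf
  ; no-0Z1Z0                = squarefree-no-0Z1Z0 sf no-010 no-212
  ; short-images-squarefree = λ {u} F l → τ-keeps-squarefree-short u l (squarefree-factor F sf)
                                            (λ F′ → no-010 (factor-trans F′ F)) (λ F′ → no-212 (factor-trans F′ F))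
  ; pairs-synchronize       = squarefree-pairs-τ-sync sf
  }

τpow-grows : ∀ k → Σ (List T) λ r → (r ≢ []) × (τpow (suc k) ≡ τpow k ++ r)
τpow-grows zero    = suc zero ∷ suc (suc zero) ∷ [] , (λ ()) , refl
τpow-grows (suc k) with τpow-grows k
... | r , r≢[] , eq = Hτ r , Hτ-nonempty τ-nonerasing r≢[] , trans (cong Hτ eq) (Hτ-++ (τpow k) r)

τpow-avoids-010 : ∀ k → ¬ Factor p010 (τpow k)
τpow-avoids-010 k F with τpow-grows k
... | r , _ , eq = τ-image-avoids-010 (τpow k) (factor-trans F (subst (Factor (τpow k)) (sym eq) (prefix-factor (τpow k) r)))

τpow-avoids-212 : ∀ k → ¬ Factor p212 (τpow k)
τpow-avoids-212 k F with τpow-grows k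
... | r , _ , eq = τ-image-avoids-212 (τpow k) (factor-trans F (subst (Factor (τpow k)) (sym eq) (prefix-factor (τpow k) r)))

τpow-squarefree : ∀ k → SquareFree (τpow k)
τpow-squarefree zero    = toWitness {a? = squarefree? (zero ∷ [])} tt
τpow-squarefree (suc k) =
  τ-Criterion.image-squarefree (τ-admissible (τpow-squarefree k) (τpow-avoids-010 k) (τpow-avoids-212 k))

-- Prefixes of vtm

τpow-prefix : ∀ {k m} → k ≤ m → Σ (List T) λ r → τpow m ≡ τpow k ++ r
τpow-prefix k≤m = go (≤⇒≤′ k≤m)
  where
  go : ∀ {k m} → k ≤′ m → Σ (List T) λ r → τpow m ≡ τpow k ++ r
  go ≤′-refl = [] , sym (++-identityʳ _)
  go {k} (≤′-step {m} k≤′m) with go k≤′m | τpow-grows m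
  ... | r , eq | r′ , _ , eq′ = r ++ r′ , trans eq′ (trans (cong (_++ r′) eq) (++-assoc (τpow k) r r′))

τpow-length : ∀ k → k < length (τpow k)
τpow-length zero    = s≤s z≤n
τpow-length (suc k) with τpow-grows k
... | []    , []≢[] , _  = ⊥-elim ([]≢[] refl)
... | x ∷ r , _     , eq = ≤-trans (s≤s (τpow-length k))
      (≤-trans (m<m+n (length (τpow k)) (s≤s z≤n)) (≤-reflexive (sym (trans (cong length eq) (length-++ (τpow k))))))

nth-++ : ∀ {B : Set} (d : B) L r j → j < length L → nth d (L ++ r) j ≡ nth d L j
nth-++ d (x ∷ L) r zero    _        = refl
nth-++ d (x ∷ L) r (suc j) (s≤s j<) = nth-++ d L r j j<

vtm-letter : ∀ {j n} → j < n → vtm j ≡ nth zero (τpow n) j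
vtm-letter {j} j<n with τpow-prefix j<n
... | r , eq = sym (trans (cong (λ t → nth zero t j) eq) (nth-++ zero (τpow (suc j)) r j (<-trans (n<1+n j) (τpow-length (suc j)))))

applyUpTo-prefix : ∀ {B : Set} (d : B) f n L → n ≤ length L → (∀ j → j < n → f j ≡ nth d L j) →
  Σ (List B) λ r → L ≡ applyUpTo f n ++ r
applyUpTo-prefix d f zero    L       _        _     = L , refl
applyUpTo-prefix d f (suc n) (x ∷ L) (s≤s n≤) agree
  with applyUpTo-prefix d (f ∘ suc) n L n≤ (λ j j< → agree (suc j) (s≤s j<))
... | r , eq = r , cong₂ _∷_ (sym (agree zero (s≤s z≤n))) eq

segment-applyUpTo : ∀ {B : Set} (x : ℕ → B) i n → segment x i n ≡ applyUpTo (λ j → x (i + j)) n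
segment-applyUpTo x i n = map-applyUpTo (λ j → j) (λ j → x (i + j)) n

vtm-prefix : ∀ n → Factor (segment vtm 0 n) (τpow n)
vtm-prefix n with applyUpTo-prefix zero vtm n (τpow n) (<⇒≤ (τpow-length n)) (λ j → vtm-letter)
... | r , eq = [] , r , trans eq (cong (_++ r) (sym (segment-applyUpTo vtm 0 n)))

applyUpTo-prefix-of-longer : ∀ {B : Set} (f : ℕ → B) {m n} → m ≤ n → Σ (List B) λ t → applyUpTo f n ≡ applyUpTo f m ++ t
applyUpTo-prefix-of-longer f {n = n} z≤n       = applyUpTo f n , refl
applyUpTo-prefix-of-longer f         (s≤s m≤n) with applyUpTo-prefix-of-longer (f ∘ suc) m≤n
... | t , eq = t , cong (f zero ∷_) eq

applyUpTo-factor : ∀ {B : Set} (f : ℕ → B) n x u z → applyUpTo f n ≡ x ++ u ++ z →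
  u ≡ applyUpTo (λ j → f (length x + j)) (length u)
applyUpTo-factor f n       []      []      z eq = refl
applyUpTo-factor f (suc n) []      (c ∷ u) z eq with ∷-injective eq
... | refl , eq′ = cong (c ∷_) (applyUpTo-factor (f ∘ suc) n [] u z eq′)
applyUpTo-factor f (suc n) (c ∷ x) u       z eq = applyUpTo-factor (f ∘ suc) n x u z (proj₂ (∷-injective eq))

segment-short-factor : ∀ {B : Set} (x : ℕ → B) n {m u} → Factor u (segment x 0 n) → length u ≤ m →
  Σ ℕ λ i → Σ (List B) λ t → segment x i m ≡ u ++ t
segment-short-factor x n {m} {u} (p , s , eq) l with applyUpTo-prefix-of-longer (λ j → x (length p + j)) l
... | t , eq′ = length p , t , trans (segment-applyUpTo x (length p) m) (trans eq′ (cong (_++ t) (sym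
      (applyUpTo-factor x n p u s (trans (sym (segment-applyUpTo x 0 n)) eq)))))

distinct-letters-adjacent-in-vtm : ∀ a b → a ≢ b → Σ ℕ λ i → Σ (List T) λ rest → segment vtm i 5 ≡ a ∷ b ∷ rest
distinct-letters-adjacent-in-vtm zero             zero             a≢b = ⊥-elim (a≢b refl)
distinct-letters-adjacent-in-vtm zero             (suc zero)       _   = 0 , _ , refl
distinct-letters-adjacent-in-vtm zero             (suc (suc zero)) _   = 3 , _ , refl
distinct-letters-adjacent-in-vtm (suc zero)       zero             _   = 5 , _ , refl
distinct-letters-adjacent-in-vtm (suc zero)       (suc zero)       a≢b = ⊥-elim (a≢b refl)
distinct-letters-adjacent-in-vtm (suc zero)       (suc (suc zero)) _   = 1 , _ , refl
distinct-letters-adjacent-in-vtm (suc (suc zero)) zero             _   = 2 , _ , refl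
distinct-letters-adjacent-in-vtm (suc (suc zero)) (suc zero)       _   = 4 , _ , refl
distinct-letters-adjacent-in-vtm (suc (suc zero)) (suc (suc zero)) a≢b = ⊥-elim (a≢b refl)

-- The morphism g

module _ {A : Set} (g : T → List A)
  (overlap⇒010 : ∀ a b c → Overlap g a b c → (a ≡ zero) × (b ≡ suc zero) × (c ≡ zero))
  where

  erased-next-to-nonerased : ∀ {a b} → g a ≢ [] → g b ≡ [] → (a ≡ zero) × (b ≡ suc zero)
  erased-next-to-nonerased {a} {b} ga≢[] gb≡[]
    with overlap⇒010 a b a (g a , [] , [] , g a , sym (++-identityʳ (g a)) , gb≡[] , refl ,
                            (λ []≡ga → ga≢[] (sym []≡ga)) , ga≢[])
  ... | a≡0 , b≡1 , _ = a≡0 , b≡1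

  erasure-uniform : (∀ a → g a ≢ []) ⊎ (∀ a → g a ≡ [])
  erasure-uniform with empty? (g zero) | empty? (g (suc zero)) | empty? (g (suc (suc zero)))
  ... | no  n₀ | no  n₁ | no  n₂ = inj₁ λ { zero → n₀ ; (suc zero) → n₁ ; (suc (suc zero)) → n₂ }
  ... | yes e₀ | yes e₁ | yes e₂ = inj₂ λ { zero → e₀ ; (suc zero) → e₁ ; (suc (suc zero)) → e₂ }
  ... | no  n₀ | no  n₁ | yes e₂ = case proj₂ (erased-next-to-nonerased n₀ e₂) of λ ()
  ... | no  n₀ | yes e₁ | no  n₂ = case proj₁ (erased-next-to-nonerased n₂ e₁) of λ ()
  ... | no  n₀ | yes e₁ | yes e₂ = case proj₂ (erased-next-to-nonerased n₀ e₂) of λ ()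
  ... | yes e₀ | no  n₁ | _      = case proj₁ (erased-next-to-nonerased n₁ e₀) of λ ()
  ... | yes e₀ | yes e₁ | no  n₂ = case proj₁ (erased-next-to-nonerased n₂ e₀) of λ ()

  module _ (injective : ∀ a b → g a ≡ g b → a ≡ b) where

    private
      other : T → T
      other zero             = suc zero
      other (suc zero)       = suc (suc zero)
      other (suc (suc zero)) = suc zero

      other≢ : ∀ a → other a ≢ a
      other≢ zero             ()
      other≢ (suc zero)       ()
      other≢ (suc (suc zero)) ()

      other≢zero : ∀ a → other a ≢ zero
      other≢zero zero             ()
      other≢zero (suc zero)       ()
      other≢zero (suc (suc zero)) ()

    overlaps⇒prefix-free : ∀ a b w → g a ++ w ≡ g b → w ≡ []
    overlaps⇒prefix-free a b []      _  = refl
    overlaps⇒prefix-free a b (x ∷ w) eq = ⊥-elim (other≢zero a (proj₁ (overlap⇒010 (other a) a b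
      (g (other a) , [] , g a , x ∷ w , sym (++-identityʳ _) , sym (++-identityʳ _) , sym eq , (λ ()) ,
       λ g-other≡ga → other≢ a (injective (other a) a g-other≡ga)))))

    overlaps⇒suffix-free : ∀ a b u → u ++ g a ≡ g b → u ≡ []
    overlaps⇒suffix-free a b []      _  = refl
    overlaps⇒suffix-free a b (x ∷ u) eq = ⊥-elim (other≢zero a (proj₂ (proj₂ (overlap⇒010 b a (other a)
      (x ∷ u , g a , [] , g (other a) , sym eq , refl , refl ,
       (λ ga≡g-other → other≢ a (sym (injective a (other a) ga≡g-other))) , λ ())))))

factors-squarefree⇒injective : ∀ {A : Set} (g : T → List A) → (∀ a → g a ≢ []) →
  (∀ i → SquareFree (morph g (segment vtm i 5))) → ∀ a b → g a ≡ g b → a ≡ b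
factors-squarefree⇒injective g nonerasing factors-squarefree a b ga≡gb with a ≟ᶠ b
... | yes a≡b = a≡b
... | no  a≢b with distinct-letters-adjacent-in-vtm a b a≢b
...   | i , rest , segment≡ = ⊥-elim (factors-squarefree i ([] , g a , morph g rest , nonerasing a ,
          trans (cong (morph g) segment≡) (cong (λ t → g a ++ t ++ morph g rest) (sym ga≡gb))))

module VtmImage {k : ℕ} (g : T → List (Fin k))
  (factors-squarefree : ∀ i → SquareFree (morph g (segment vtm i 5)))
  (overlap⇒010 : ∀ a b c → Overlap g a b c → (a ≡ zero) × (b ≡ suc zero) × (c ≡ zero))
  (v : T → List (Fin k))
  (v-suffix : ∀ a → Σ (List (Fin k)) λ u → g a ≡ u ++ v a)
  (v-synchronizing : ∀ a (y : List T) (x z : List (Fin k)) → morph g y ≡ x ++ v a ++ z →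
                       Σ (List T) λ y′ → z ≡ morph g y′)
  (nonerasing : ∀ a → g a ≢ [])
  where

  private
    injective : ∀ a b → g a ≡ g b → a ≡ b
    injective = factors-squarefree⇒injective g nonerasing factors-squarefree

    synchronizing : ∀ {a} → ⊤ → ∀ W X M → morph g W ≡ X ++ g a ++ M → Σ (List T) λ y → M ≡ morph g y
    synchronizing {a} _ W X M eq with v-suffix a
    ... | u , ga≡uv = v-synchronizing a W (X ++ u) M (trans eq (trans (cong (λ t → X ++ t ++ M) ga≡uv)
                        (trans (cong (X ++_) (++-assoc u (v a) M)) (sym (++-assoc X u _)))))

  open Criterion g nonerasing injective (overlaps⇒prefix-free g overlap⇒010 injective)
    (overlaps⇒suffix-free g overlap⇒010 injective) overlap⇒010 (λ _ → ⊤) (λ _ → yes tt) synchronizing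
  open Morphism g using (H; H-++)

  vtm-prefix-admissible : ∀ n → Admissible (segment vtm 0 n)
  vtm-prefix-admissible n = record
    { squarefree              = squarefree-factor (vtm-prefix n) (τpow-squarefree n)
    ; no-0Z1Z0                = λ Z F → squarefree-no-0Z1Z0 (τpow-squarefree n) (τpow-avoids-010 n) (τpow-avoids-212 n) Z
                                          (factor-trans F (vtm-prefix n))
    ; short-images-squarefree = short-images
    ; pairs-synchronize       = λ _ → inj₁ tt
    }
    where
    short-images : ∀ {u} → Factor u (segment vtm 0 n) → length u ≤ 5 → SquareFree (H u)
    short-images {u} F l with segment-short-factor vtm n F l
    ... | i , t , segment≡ = squarefree-factor ([] , H t , H-++ u t)
                               (subst (SquareFree ∘ H) segment≡ (factors-squarefree i))

  vtm-prefix-image-squarefree : ∀ n → SquareFree (H (segment vtm 0 n))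
  vtm-prefix-image-squarefree n = image-squarefree (vtm-prefix-admissible n)

mainTheorem3 : (k : ℕ) → (g : T → List (Fin k)) →
    -- (1) g(u) squarefree for every factor u of vtm of length 5
    (∀ i → SquareFree (morph g (segment vtm i 5))) →
    -- (2) the only triple (a,b,c) admitting such u,v,z,w is (0,1,0)
    (∀ a b c → (Σ (List (Fin k)) λ u → Σ (List (Fin k)) λ v →
                Σ (List (Fin k)) λ z → Σ (List (Fin k)) λ w →
                  (g a ≡ u ++ v) × (g b ≡ z ++ v) × (g c ≡ z ++ w) × (v ≢ w) × (u ≢ z)) →
              (a ≡ zero) × (b ≡ suc zero) × (c ≡ zero)) →
    -- (3) synchronization suffixes v_a
    (Σ (T → List (Fin k)) λ v →
      (∀ a → Σ (List (Fin k)) λ u → g a ≡ u ++ v a) ×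
      (∀ a (y : List T) (x z : List (Fin k)) → morph g y ≡ x ++ v a ++ z →
          Σ (List T) λ y′ → z ≡ morph g y′)) →
    ImageSquareFree g vtm
mainTheorem3 k g factors-squarefree overlap⇒010 (v , v-suffix , v-synchronizing) n
  with erasure-uniform g overlap⇒010
... | inj₁ nonerasing =
      VtmImage.vtm-prefix-image-squarefree g factors-squarefree overlap⇒010 v v-suffix v-synchronizing nonerasing n
... | inj₂ erased = subst SquareFree (sym (Morphism.H-erased g erased (segment vtm 0 n))) squarefree-[]
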